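{- For every integer $d\ge2$, let $Q_d(n)$ be the polynomial with rational coefficients such that $|P_n^d|=Q_d(n)$ for all integers $n\ge 0$. Then the coefficient of $n^{d-2}$ in $Q_d$ equals $\dfrac{2^{d-2}(d+4)}{6\,(d-2)!}$.
   Context: For integers $d\ge 1$ and $n\ge 0$, let $e_1,\dots,e_d$ be the standard unit vectors of $\mathbb{Z}^d$ and let $P_n^d=\{X_1+X_2+\cdots+X_n : X_i\in\{\pm e_1,\dots,\pm e_d\}\text{ for } i=1,\dots,n\}\subseteq\mathbb{Z}^d$ be the set of possible positions of a nearest-neighbour walk in $\mathbb{Z}^d$ starting at the origin after exactly $n$ unit steps (so $P_0^d=\{0\}$). $|P_n^d|$ denotes its cardinality. For each $d$, $n\mapsto|P_n^d|$ agrees on all $n\ge0$ with a (unique) polynomial in $n$ of degree $d$. -}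

module Defs where

open import Data.Nat using (ℕ; zero; suc; _!; _^_; NonZero) renaming (_*_ to _*ℕ_; _+_ to _+ℕ_)
open import Data.Nat.Properties using (m*n≢0; _!≢0)
open import Data.Integer as ℤ using (ℤ; +_)
open import Data.Rational using (ℚ; _/_; _+_; _*_; 0ℚ)
open import Data.Fin using (Fin)
open import Data.Vec using (Vec; replicate; zipWith; updateAt)
open import Data.Vec.Properties using (≡-dec)
open import Data.List using (List; []; _∷_; map; concatMap; allFin; length; deduplicate)

unitVec : ∀ {d} → Fin d → ℤ → Vec ℤ d
unitVec i s = updateAt (replicate _ (+ 0)) i (λ _ → s)

steps : (d : ℕ) → List (Vec ℤ d)
steps d = concatMap (λ i → unitVec i (+ 1) ∷ unitVec i (ℤ.- (+ 1)) ∷ []) (allFin d)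

_+v_ : ∀ {d} → Vec ℤ d → Vec ℤ d → Vec ℤ d
_+v_ = zipWith ℤ._+_

-- List (with repetitions) of all X_1 + … + X_n with X_i ∈ steps d
endpoints : (d n : ℕ) → List (Vec ℤ d)
endpoints d zero    = replicate d (+ 0) ∷ []
endpoints d (suc n) = concatMap (λ p → map (p +v_) (steps d)) (endpoints d n)

cardP : (d n : ℕ) → ℕ
cardP d n = length (deduplicate (≡-dec ℤ._≟_) (endpoints d n))

-- Polynomials over ℚ as coefficient lists [c_0, c_1, …]
Poly : Set
Poly = List ℚ

eval : Poly → ℕ → ℚ
eval []       n = 0ℚ
eval (c ∷ cs) n = c + ((+ n) / 1) * eval cs n

coeff : Poly → ℕ → ℚ
coeff []       k       = 0ℚ
coeff (c ∷ cs) zero    = c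
coeff (c ∷ cs) (suc k) = coeff cs k

-- 2^k (k+6) / (6 k!), i.e. 2^{d-2}(d+4)/(6 (d-2)!) with d = k+2
target : ℕ → ℚ
target k = _/_ (+ (2 ^ k *ℕ (k +ℕ 2 +ℕ 4))) (6 *ℕ k !) {{m*n≢0 6 (k !) {{_}} {{k !≢0}}}}

{-# OPTIONS --safe #-}
module Submission where

-- A point of ℤ^d is reached in exactly n steps iff its ℓ¹-norm is at most n and has the
-- parity of n. Splitting off the first coordinate a ∈ [-n, n] gives
-- |P_n^{d+1}| = |P_n^d| + 2 Σ_{m<n} |P_m^d|, and the hockey-stick identity turns this into
-- |P_n^{d+1}| = Σ_k β(d,k) C(n,k) with β(d+1,k+1) = β(d,k+1) + 2 β(d,k).
-- For d = K + 2 only k = K, K+1, K+2 contribute to n^K: the coefficient of n^K in k! C(n,k)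
-- is the Stirling number s(k,K), and β(K+1,K) = 2^K (K+1)(K+4)/4, β(K+1,K+1) = 2^K (K+3),
-- β(K+1,K+2) = 2^(K+1); together they give 2^K (K+6) / (6 K!). Finally a rational polynomial
-- vanishing on ℕ is zero, so Q has the same coefficients.

open import Defs

module RationalPolynomial where

  open import Data.Nat as ℕ using (ℕ; zero; suc)
  open import Data.Integer as ℤ using (+_)
  import Data.Integer.Solver
  open import Data.Rational as ℚ using (ℚ; _/_; 0ℚ; 1ℚ; mkℚ; toℚᵘ; _+_; _*_; _-_; -_; 1/_)
  open import Data.Rational.Properties
  import Data.Rational.Solver
  open import Data.Rational.Unnormalised as ℚᵘ using (mkℚᵘ; *≡*)
  import Data.Rational.Unnormalised.Properties as ℚᵘ
  open import Data.Nat.Coprimality using (1-coprimeTo) renaming (sym to coprime-sym)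
  open import Algebra.Properties.Group +-0-group using (x∙y⁻¹≈ε⇒x≈y; x≈y⇒x∙y⁻¹≈ε)
  open import Data.List using ([]; _∷_)
  open import Data.Vec using (Vec; []; _∷_; toList; fromList)
  open import Data.Vec.Properties using (toList∘fromList)
  open import Data.Product using (_×_; _,_)
  open import Relation.Binary.PropositionalEquality

  fromℕ : ℕ → ℚ
  fromℕ n = + n / 1

  toℚᵘ-/ : ∀ a p .{{_ : ℕ.NonZero p}} → toℚᵘ (a / p) ℚᵘ.≃ mkℚᵘ a (ℕ.pred p)
  toℚᵘ-/ a (suc p) = toℚᵘ-fromℚᵘ (mkℚᵘ a p)

  /-cross : ∀ a b p q .{{_ : ℕ.NonZero p}} .{{_ : ℕ.NonZero q}} →
            a ℤ.* + q ≡ b ℤ.* + p → a / p ≡ b / q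
  /-cross a b (suc p) (suc q) eq = fromℚᵘ-cong {mkℚᵘ a p} {mkℚᵘ b q} (*≡* eq)

  a/p+b/p≡[a+b]/p : ∀ a b p .{{_ : ℕ.NonZero p}} → a / p + b / p ≡ (a ℤ.+ b) / p
  a/p+b/p≡[a+b]/p a b p@(suc _) = toℚᵘ-injective (begin-equality
    toℚᵘ (a / p + b / p)                     ≃⟨ toℚᵘ-homo-+ (a / p) (b / p) ⟩
    toℚᵘ (a / p) ℚᵘ.+ toℚᵘ (b / p)          ≃⟨ ℚᵘ.+-cong (toℚᵘ-/ a p) (toℚᵘ-/ b p) ⟩
    mkℚᵘ a _ ℚᵘ.+ mkℚᵘ b _                  ≃⟨ *≡* (ring a b (+ p)) ⟩
    mkℚᵘ (a ℤ.+ b) _                         ≃⟨ ℚᵘ.≃-sym (toℚᵘ-/ (a ℤ.+ b) p) ⟩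
    toℚᵘ ((a ℤ.+ b) / p)                     ∎)
    where
    open ℚᵘ.≤-Reasoning
    open Data.Integer.Solver.+-*-Solver
    ring : ∀ a b s → (a ℤ.* s ℤ.+ b ℤ.* s) ℤ.* s ≡ (a ℤ.+ b) ℤ.* (s ℤ.* s)
    ring = solve 3 (λ a b s → (a :* s :+ b :* s) :* s := (a :+ b) :* (s :* s)) refl

  z/1*a/p≡[z*a]/p : ∀ z a p .{{_ : ℕ.NonZero p}} → z / 1 * (a / p) ≡ (z ℤ.* a) / p
  z/1*a/p≡[z*a]/p z a p@(suc _) = toℚᵘ-injective (begin-equality
    toℚᵘ (z / 1 * (a / p))                  ≃⟨ toℚᵘ-homo-* (z / 1) (a / p) ⟩
    toℚᵘ (z / 1) ℚᵘ.* toℚᵘ (a / p)          ≃⟨ ℚᵘ.*-cong (toℚᵘ-/ z 1) (toℚᵘ-/ a p) ⟩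
    mkℚᵘ z 0 ℚᵘ.* mkℚᵘ a _                  ≃⟨ *≡* (ring z a (+ p)) ⟩
    mkℚᵘ (z ℤ.* a) _                         ≃⟨ ℚᵘ.≃-sym (toℚᵘ-/ (z ℤ.* a) p) ⟩
    toℚᵘ ((z ℤ.* a) / p)                     ∎)
    where
    open ℚᵘ.≤-Reasoning
    open Data.Integer.Solver.+-*-Solver
    ring : ∀ z a s → (z ℤ.* a) ℤ.* s ≡ (z ℤ.* a) ℤ.* (+ 1 ℤ.* s)
    ring = solve 3 (λ z a s → (z :* a) :* s := (z :* a) :* (con (+ 1) :* s)) refl

  fromℕ-suc : ∀ n → fromℕ (suc n) ≡ 1ℚ + fromℕ n
  fromℕ-suc n = sym (a/p+b/p≡[a+b]/p (+ 1) (+ n) 1)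

  fromℕ-suc-cancelˡ : ∀ n p → fromℕ (suc n) * p ≡ 0ℚ → p ≡ 0ℚ
  fromℕ-suc-cancelˡ n p eq = begin
    p               ≡⟨ *-identityˡ p ⟨
    1ℚ * p          ≡⟨ cong (_* p) (*-inverseˡ x) ⟨
    (1/ x * x) * p  ≡⟨ *-assoc (1/ x) x p ⟩
    1/ x * (x * p)  ≡⟨ cong (1/ x *_) (subst (λ y → y * p ≡ 0ℚ) fromℕ-suc≡mkℚ eq) ⟩
    1/ x * 0ℚ       ≡⟨ *-zeroʳ (1/ x) ⟩
    0ℚ              ∎
    where
    open ≡-Reasoning
    x : ℚ
    x = mkℚ (+ suc n) 0 (coprime-sym (1-coprimeTo (suc n)))
    fromℕ-suc≡mkℚ : fromℕ (suc n) ≡ x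
    fromℕ-suc≡mkℚ = normalize-coprime (coprime-sym (1-coprimeTo (suc n)))

  addMul1+x : ∀ {L} → ℚ → Vec ℚ L → Vec ℚ (suc L)
  addMul1+x p []      = p ∷ []
  addMul1+x p (s ∷ S) = (p + s) ∷ addMul1+x s S

  eval-addMul1+x : ∀ {L} p (S : Vec ℚ L) n →
                   eval (toList (addMul1+x p S)) n ≡ p + (1ℚ + fromℕ n) * eval (toList S) n
  eval-addMul1+x p [] n = begin
    p + fromℕ n * 0ℚ         ≡⟨ cong (λ e → p + e) (*-zeroʳ (fromℕ n)) ⟩
    p + 0ℚ                   ≡⟨ cong (λ e → p + e) (*-zeroʳ (1ℚ + fromℕ n)) ⟨
    p + (1ℚ + fromℕ n) * 0ℚ  ∎
    where open ≡-Reasoning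
  eval-addMul1+x p (s ∷ S) n = begin
    (p + s) + fromℕ n * eval (toList (addMul1+x s S)) n
      ≡⟨ cong (λ e → (p + s) + fromℕ n * e) (eval-addMul1+x s S n) ⟩
    (p + s) + fromℕ n * (s + (1ℚ + fromℕ n) * eval (toList S) n)
      ≡⟨ ring p s (fromℕ n) (eval (toList S) n) ⟩
    p + (1ℚ + fromℕ n) * (s + fromℕ n * eval (toList S) n) ∎
    where
    open ≡-Reasoning
    open Data.Rational.Solver.+-*-Solver
    ring : ∀ p s x e → (p + s) + x * (s + (1ℚ + x) * e) ≡ p + (1ℚ + x) * (s + x * e)
    ring = solve 4 (λ p s x e → (p :+ s) :+ x :* (s :+ (con 1ℚ :+ x) :* e)
                              := p :+ (con 1ℚ :+ x) :* (s :+ x :* e)) refl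

  addMul1+x-vanishes : ∀ {L} p (S : Vec ℚ L) → (∀ k → coeff (toList (addMul1+x p S)) k ≡ 0ℚ) →
                       p ≡ 0ℚ × (∀ k → coeff (toList S) k ≡ 0ℚ)
  addMul1+x-vanishes p [] h = h 0 , λ _ → refl
  addMul1+x-vanishes p (s ∷ S) h with addMul1+x-vanishes s S (λ k → h (suc k))
  ... | s≡0 , S≡0 = p≡0 , λ { zero → s≡0 ; (suc k) → S≡0 k }
    where
    p≡0 : p ≡ 0ℚ
    p≡0 = trans (sym (+-identityʳ p)) (trans (cong (λ e → p + e) (sym s≡0)) (h 0))

  shift : ∀ {L} → Vec ℚ L → Vec ℚ L
  shift []      = []
  shift (c ∷ w) = addMul1+x c (shift w)

  eval-shift : ∀ {L} (v : Vec ℚ L) n → eval (toList (shift v)) n ≡ eval (toList v) (suc n)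
  eval-shift []      n = refl
  eval-shift (c ∷ w) n = trans (eval-addMul1+x c (shift w) n)
    (cong₂ (λ x e → c + x * e) (sym (fromℕ-suc n)) (eval-shift w n))

  shift-vanishes : ∀ {L} (v : Vec ℚ L) → (∀ k → coeff (toList (shift v)) k ≡ 0ℚ) →
                   ∀ k → coeff (toList v) k ≡ 0ℚ
  shift-vanishes []      h k = refl
  shift-vanishes (c ∷ w) h with addMul1+x-vanishes c (shift w) h
  ... | c≡0 , shift-w≡0 = λ { zero → c≡0 ; (suc k) → shift-vanishes w shift-w≡0 k }

  -- P(0) = 0 forces c = 0, and then (n + 1) W(n + 1) = 0 makes W(x + 1) vanish on ℕ.
  vanishing⇒coeff≡0 : ∀ {L} (v : Vec ℚ L) → (∀ n → eval (toList v) n ≡ 0ℚ) →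
                      ∀ k → coeff (toList v) k ≡ 0ℚ
  vanishing⇒coeff≡0 []      h k = refl
  vanishing⇒coeff≡0 (c ∷ w) h = λ { zero → c≡0 ; (suc k) → w≡0 k }
    where
    c≡0 : c ≡ 0ℚ
    c≡0 = trans (sym (trans (cong (λ e → c + e) (*-zeroˡ (eval (toList w) 0))) (+-identityʳ c))) (h 0)
    w-shift-vanishes : ∀ n → eval (toList (shift w)) n ≡ 0ℚ
    w-shift-vanishes n = trans (eval-shift w n) (fromℕ-suc-cancelˡ n _
      (trans (sym (+-identityˡ _)) (trans (cong (λ a → a + _) (sym c≡0)) (h (suc n)))))
    w≡0 : ∀ k → coeff (toList w) k ≡ 0ℚ
    w≡0 = shift-vanishes w (vanishing⇒coeff≡0 (shift w) w-shift-vanishes)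

  infixl 6 _-ₚ_
  _-ₚ_ : Poly → Poly → Poly
  A       -ₚ []      = A
  []      -ₚ (b ∷ B) = - b ∷ ([] -ₚ B)
  (a ∷ A) -ₚ (b ∷ B) = a - b ∷ (A -ₚ B)

  eval-subₚ : ∀ A B n → eval (A -ₚ B) n ≡ eval A n - eval B n
  eval-subₚ A       []      n = sym (+-identityʳ (eval A n))
  eval-subₚ []      (b ∷ B) n = trans (cong (λ e → - b + fromℕ n * e) (eval-subₚ [] B n))
                                    (ring b (fromℕ n) (eval B n))
    where
    open Data.Rational.Solver.+-*-Solver
    ring : ∀ b x e → - b + x * (0ℚ - e) ≡ 0ℚ - (b + x * e)
    ring = solve 3 (λ b x e → :- b :+ x :* (con 0ℚ :- e) := con 0ℚ :- (b :+ x :* e)) refl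
  eval-subₚ (a ∷ A) (b ∷ B) n = trans (cong (λ e → a - b + fromℕ n * e) (eval-subₚ A B n))
                                    (ring a b (fromℕ n) (eval A n) (eval B n))
    where
    open Data.Rational.Solver.+-*-Solver
    ring : ∀ a b x e f → a - b + x * (e - f) ≡ (a + x * e) - (b + x * f)
    ring = solve 5 (λ a b x e f → a :- b :+ x :* (e :- f) := (a :+ x :* e) :- (b :+ x :* f)) refl

  coeff-subₚ : ∀ A B k → coeff (A -ₚ B) k ≡ coeff A k - coeff B k
  coeff-subₚ A       []      k       = sym (+-identityʳ (coeff A k))
  coeff-subₚ []      (b ∷ B) zero    = sym (+-identityˡ (- b))
  coeff-subₚ []      (b ∷ B) (suc k) = coeff-subₚ [] B k
  coeff-subₚ (a ∷ A) (b ∷ B) zero    = refl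
  coeff-subₚ (a ∷ A) (b ∷ B) (suc k) = coeff-subₚ A B k

  coeff-unique : ∀ P R → (∀ n → eval P n ≡ eval R n) → ∀ k → coeff P k ≡ coeff R k
  coeff-unique P R P≗R k = x∙y⁻¹≈ε⇒x≈y _ _ (begin
    coeff P k - coeff R k               ≡⟨ coeff-subₚ P R k ⟨
    coeff (P -ₚ R) k                    ≡⟨ cong (λ D → coeff D k) (toList∘fromList (P -ₚ R)) ⟨
    coeff (toList (fromList (P -ₚ R))) k ≡⟨ vanishing⇒coeff≡0 (fromList (P -ₚ R)) P-R≗0 k ⟩
    0ℚ                                   ∎)
    where
    open ≡-Reasoning
    P-R≗0 : ∀ n → eval (toList (fromList (P -ₚ R))) n ≡ 0ℚ
    P-R≗0 n = begin
      eval (toList (fromList (P -ₚ R))) n ≡⟨ cong (λ D → eval D n) (toList∘fromList (P -ₚ R)) ⟩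
      eval (P -ₚ R) n                     ≡⟨ eval-subₚ P R n ⟩
      eval P n - eval R n                 ≡⟨ x≈y⇒x∙y⁻¹≈ε (P≗R n) ⟩
      0ℚ                                  ∎

module Walks where

  open import Data.Nat as ℕ using (ℕ; zero; suc; _≤_; _∸_; z≤n; s≤s; parity)
  import Data.Nat.Properties as ℕ
  open import Data.Parity.Base using (Parity; 0ℙ; 1ℙ)
  open import Data.Integer as ℤ using (ℤ; +_; -[1+_]; ∣_∣)
  import Data.Integer.Properties as ℤ
  open import Data.Fin using (Fin) renaming (zero to fzero; suc to fsuc)
  open import Data.Vec using (Vec; []; _∷_; replicate; head)
  open import Data.List using (List; []; _∷_; map; concatMap; allFin; length; deduplicate)
  open import Data.Product using (Σ-syntax; _×_; _,_)
  open import Data.Sum using (_⊎_; inj₁; inj₂)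
  open import Data.List.Membership.Propositional using (_∈_; find; lose)
  open import Data.List.Membership.Propositional.Properties
    using (∈-concatMap⁻; ∈-concatMap⁺; ∈-map⁻; ∈-map⁺; ∈-allFin)
  open import Data.List.Relation.Unary.Any using (here; there)
  open import Data.List.Relation.Unary.All as All using ([]; _∷_)
  open import Data.List.Relation.Unary.AllPairs using ([]; _∷_)
  open import Data.List.Relation.Unary.Unique.Propositional using (Unique)
  import Data.List.Relation.Unary.Unique.Propositional.Properties as Unique
  open import Data.List.Relation.Binary.Disjoint.Propositional using (Disjoint)
  open import Data.List.Properties using (length-++; length-map)
  open import Data.Vec.Properties using (≡-dec)
  open import Data.List.Membership.Propositional.Properties using (∈-deduplicate⁺; ∈-deduplicate⁻)
  open import Data.List.Membership.Propositional.Properties.WithK using (unique∧set⇒bag)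
  open import Data.List.Relation.Binary.BagAndSetEquality using (∼bag⇒↭)
  open import Data.List.Relation.Binary.Permutation.Propositional.Properties using (↭-length)
  import Data.List.Relation.Unary.Unique.DecPropositional.Properties as DecUnique
  open import Function.Bundles using (mk⇔)
  open import Relation.Binary.Definitions using (DecidableEquality)
  open import Relation.Binary.PropositionalEquality

  Sign : ℤ → Set
  Sign σ = σ ≡ + 1 ⊎ σ ≡ -[1+ 0 ]

  ∣i+σ∣-step : ∀ i {σ} → Sign σ → ∣ i ℤ.+ σ ∣ ≡ suc ∣ i ∣ ⊎ suc ∣ i ℤ.+ σ ∣ ≡ ∣ i ∣
  ∣i+σ∣-step (+ m)          (inj₁ refl) = inj₁ (ℕ.+-comm m 1)
  ∣i+σ∣-step -[1+ zero ]    (inj₁ refl) = inj₂ refl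
  ∣i+σ∣-step -[1+ suc m ]   (inj₁ refl) = inj₂ refl
  ∣i+σ∣-step (+ zero)       (inj₂ refl) = inj₁ refl
  ∣i+σ∣-step (+ suc m)      (inj₂ refl) = inj₂ refl
  ∣i+σ∣-step -[1+ m ]       (inj₂ refl) = inj₁ (cong (λ k → suc (suc k)) (ℕ.+-identityʳ m))

  -- The points of P_n^d: ∣ v ∣₁ ≤ n and ∣ v ∣₁ ≡ n (mod 2), unfolded one coordinate at a time.
  Reachable : (d : ℕ) → ℕ → Vec ℤ d → Set
  Reachable zero    n []      = parity n ≡ 0ℙ
  Reachable (suc d) n (a ∷ v) = ∣ a ∣ ≤ n × Reachable d (n ∸ ∣ a ∣) v

  Reachable-+2 : ∀ d n v → Reachable d n v → Reachable d (2 ℕ.+ n) v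
  Reachable-+2 zero    n []      r          = r
  Reachable-+2 (suc d) n (a ∷ v) (a≤n , r) =
    ℕ.≤-trans a≤n (ℕ.m≤n+m n 2) ,
    subst (λ m → Reachable d m v) (sym (ℕ.+-∸-assoc 2 a≤n)) (Reachable-+2 d (n ∸ ∣ a ∣) v r)

  origin : ∀ d → Vec ℤ d
  origin d = replicate d (+ 0)

  +v-origin : ∀ {d} (v : Vec ℤ d) → v +v origin d ≡ v
  +v-origin []      = refl
  +v-origin (a ∷ v) = cong₂ _∷_ (ℤ.+-identityʳ a) (+v-origin v)

  Reachable-step : ∀ d n p (i : Fin d) {σ} → Sign σ → Reachable d n p →
                   Reachable d (suc n) (p +v unitVec i σ)
  Reachable-step (suc d) n (a ∷ p) fzero {σ} s (a≤n , r) rewrite +v-origin p with ∣i+σ∣-step a s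
  ... | inj₁ e = subst (_≤ suc n) (sym e) (s≤s a≤n) , subst (λ m → Reachable d (suc n ∸ m) p) (sym e) r
  ... | inj₂ e = back-and-forth ∣ a ℤ.+ σ ∣ n (subst (_≤ n) (sym e) a≤n)
                   (subst (λ m → Reachable d (n ∸ m) p) (sym e) r)
    where
    back-and-forth : ∀ t n → suc t ≤ n → Reachable d (n ∸ suc t) p → t ≤ suc n × Reachable d (suc n ∸ t) p
    back-and-forth t (suc n) (s≤s t≤n) r =
      ℕ.≤-trans t≤n (ℕ.m≤n+m n 2) ,
      subst (λ m → Reachable d m p) (sym (ℕ.+-∸-assoc 2 t≤n)) (Reachable-+2 d (n ∸ t) p r)
  Reachable-step (suc d) n (a ∷ p) (fsuc i) {σ} s (a≤n , r) rewrite ℤ.+-identityʳ a =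
    ℕ.≤-trans a≤n (ℕ.n≤1+n n) ,
    subst (λ m → Reachable d m (p +v unitVec i σ)) (sym (ℕ.+-∸-assoc 1 a≤n)) (Reachable-step d (n ∸ ∣ a ∣) p i s r)

  data LastStep d n (v : Vec ℤ d) : Set where
    lastStep : ∀ p i {σ} → Sign σ → Reachable d n p → v ≡ p +v unitVec i σ → LastStep d n v

  Reachable⇒LastStep : ∀ d n v → Reachable (suc d) (suc n) v → LastStep (suc d) n v
  Reachable⇒LastStep d n (+ suc m ∷ w) (s≤s m≤n , r) =
    lastStep (+ m ∷ w) fzero (inj₁ refl) (m≤n , r)
      (cong₂ _∷_ (cong +_ (ℕ.+-comm 1 m)) (sym (+v-origin w)))
  Reachable⇒LastStep d n (-[1+ m ] ∷ w) (s≤s m≤n , r) =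
    lastStep (ℤ.- + m ∷ w) fzero (inj₂ refl)
      (subst (_≤ n) (sym ∣-m∣≡m) m≤n , subst (λ k → Reachable d (n ∸ k) w) (sym ∣-m∣≡m) r)
      (cong₂ _∷_ (-[1+m]≡-m-1 m) (sym (+v-origin w)))
    where
    ∣-m∣≡m : ∣ ℤ.- + m ∣ ≡ m
    ∣-m∣≡m = ℤ.∣-i∣≡∣i∣ (+ m)
    -[1+m]≡-m-1 : ∀ m → -[1+ m ] ≡ ℤ.- + m ℤ.+ -[1+ 0 ]
    -[1+m]≡-m-1 zero    = refl
    -[1+m]≡-m-1 (suc m) = cong (λ k → -[1+ suc k ]) (sym (ℕ.+-identityʳ m))
  Reachable⇒LastStep zero    (suc n) (+ zero ∷ []) (_ , r) =
    lastStep (+ 1 ∷ []) fzero (inj₂ refl) (s≤s z≤n , r) refl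
  Reachable⇒LastStep (suc d) n (+ zero ∷ w) (_ , r) with Reachable⇒LastStep d n w r
  ... | lastStep p i s rp refl = lastStep (+ 0 ∷ p) (fsuc i) s (z≤n , rp) refl

  origin-Reachable : ∀ d → Reachable d 0 (origin d)
  origin-Reachable zero    = refl
  origin-Reachable (suc d) = z≤n , origin-Reachable d

  Reachable-0⇒origin : ∀ d v → Reachable d 0 v → v ≡ origin d
  Reachable-0⇒origin zero    []           _        = refl
  Reachable-0⇒origin (suc d) (+ zero ∷ v) (_ , r) = cong (+ 0 ∷_) (Reachable-0⇒origin d v r)

  ±unitVec : ∀ {d} → Fin d → List (Vec ℤ d)
  ±unitVec i = unitVec i (+ 1) ∷ unitVec i (ℤ.- + 1) ∷ []

  ∈steps⇒unitVec : ∀ d s → s ∈ steps d → Σ[ i ∈ Fin d ] Σ[ σ ∈ ℤ ] Sign σ × s ≡ unitVec i σ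
  ∈steps⇒unitVec d s s∈ with find (∈-concatMap⁻ ±unitVec {xs = allFin d} s∈)
  ... | i , _ , here e         = i , + 1 , inj₁ refl , e
  ... | i , _ , there (here e) = i , -[1+ 0 ] , inj₂ refl , e

  unitVec∈steps : ∀ d (i : Fin d) {σ} → Sign σ → unitVec i σ ∈ steps d
  unitVec∈steps d i (inj₁ refl) =
    ∈-concatMap⁺ ±unitVec (lose (∈-allFin i) (here refl))
  unitVec∈steps d i (inj₂ refl) =
    ∈-concatMap⁺ ±unitVec (lose (∈-allFin i) (there (here refl)))

  ∈endpoints⇒Reachable : ∀ d n v → v ∈ endpoints d n → Reachable d n v
  ∈endpoints⇒Reachable d zero    v (here refl) = origin-Reachable d
  ∈endpoints⇒Reachable d (suc n) v v∈
    with find (∈-concatMap⁻ (λ p → map (p +v_) (steps d)) {xs = endpoints d n} v∈)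
  ... | p , p∈ , v∈p+steps with ∈-map⁻ (p +v_) v∈p+steps
  ... | s , s∈ , refl with ∈steps⇒unitVec d s s∈
  ... | i , _ , σ , refl = Reachable-step d n p i σ (∈endpoints⇒Reachable d n p p∈)

  Reachable⇒∈endpoints : ∀ d n v → Reachable (suc d) n v → v ∈ endpoints (suc d) n
  Reachable⇒∈endpoints d zero    v r = here (Reachable-0⇒origin (suc d) v r)
  Reachable⇒∈endpoints d (suc n) v r with Reachable⇒LastStep d n v r
  ... | lastStep p i σ rp refl = ∈-concatMap⁺ (λ p → map (p +v_) (steps (suc d)))
          (lose (Reachable⇒∈endpoints d n p rp) (∈-map⁺ (p +v_) (unitVec∈steps (suc d) i σ)))

  interval : ℕ → List ℤ
  interval zero    = + 0 ∷ []
  interval (suc n) = + suc n ∷ -[1+ n ] ∷ interval n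

  ∈interval⇒∣∣≤ : ∀ n {a} → a ∈ interval n → ∣ a ∣ ≤ n
  ∈interval⇒∣∣≤ zero    (here refl)         = z≤n
  ∈interval⇒∣∣≤ (suc n) (here refl)         = ℕ.≤-refl
  ∈interval⇒∣∣≤ (suc n) (there (here refl)) = ℕ.≤-refl
  ∈interval⇒∣∣≤ (suc n) (there (there a∈))  = ℕ.m≤n⇒m≤1+n (∈interval⇒∣∣≤ n a∈)

  ∣∣≤⇒∈interval : ∀ n a → ∣ a ∣ ≤ n → a ∈ interval n
  ∣∣≤⇒∈interval zero    (+ zero) _ = here refl
  ∣∣≤⇒∈interval (suc n) a a≤ with ℕ.m≤n⇒m<n∨m≡n a≤
  ... | inj₁ (s≤s a≤n) = there (there (∣∣≤⇒∈interval n a a≤n))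
  ∣∣≤⇒∈interval (suc n) (+ k)     _ | inj₂ e    = here (cong +_ e)
  ∣∣≤⇒∈interval (suc n) -[1+ k ]  _ | inj₂ refl = there (here refl)

  interval-unique : ∀ n → Unique (interval n)
  interval-unique zero    = [] ∷ []
  interval-unique (suc n) =
    ((λ ()) ∷ All.tabulate (λ a∈ e → too-big a∈ (cong ∣_∣ (sym e)))) ∷
    All.tabulate (λ a∈ e → too-big a∈ (cong ∣_∣ (sym e))) ∷ interval-unique n
    where
    too-big : ∀ {a} → a ∈ interval n → ∣ a ∣ ≢ suc n
    too-big a∈ e = ℕ.<-irrefl refl (subst (_≤ n) e (∈interval⇒∣∣≤ n a∈))

  evenOrigin : Parity → List (Vec ℤ 0)
  evenOrigin 0ℙ = [] ∷ []
  evenOrigin 1ℙ = []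

  ball : (d n : ℕ) → List (Vec ℤ d)
  ball zero    n = evenOrigin (parity n)
  ball (suc d) n = concatMap (λ a → map (a ∷_) (ball d (n ∸ ∣ a ∣))) (interval n)

  ∈ball⇒Reachable : ∀ d n v → v ∈ ball d n → Reachable d n v
  ∈ball⇒Reachable zero n [] v∈ with parity n
  ... | 0ℙ = refl
  ∈ball⇒Reachable zero n [] () | 1ℙ
  ∈ball⇒Reachable (suc d) n v v∈
    with find (∈-concatMap⁻ (λ a → map (a ∷_) (ball d (n ∸ ∣ a ∣))) {xs = interval n} v∈)
  ... | a , a∈ , v∈a∷ with ∈-map⁻ (a ∷_) v∈a∷
  ... | w , w∈ , refl = ∈interval⇒∣∣≤ n a∈ , ∈ball⇒Reachable d (n ∸ ∣ a ∣) w w∈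

  Reachable⇒∈ball : ∀ d n v → Reachable d n v → v ∈ ball d n
  Reachable⇒∈ball zero    n []      r rewrite r = here refl
  Reachable⇒∈ball (suc d) n (a ∷ w) (a≤n , r) =
    ∈-concatMap⁺ (λ a → map (a ∷_) (ball d (n ∸ ∣ a ∣)))
      (lose (∣∣≤⇒∈interval n a a≤n) (∈-map⁺ (a ∷_) (Reachable⇒∈ball d (n ∸ ∣ a ∣) w r)))

  concatMap-unique : ∀ {d} (F : ℤ → List (Vec ℤ (suc d))) (xs : List ℤ) → Unique xs →
    (∀ a → Unique (F a)) → (∀ a {v} → v ∈ F a → head v ≡ a) → Unique (concatMap F xs)
  concatMap-unique F []       _          _        _    = []
  concatMap-unique F (a ∷ as) (a∉ ∷ as!) F-unique F-head =
    Unique.++⁺ (F-unique a) (concatMap-unique F as as! F-unique F-head) disjoint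
    where
    disjoint : Disjoint (F a) (concatMap F as)
    disjoint (v∈Fa , v∈Fas) with find (∈-concatMap⁻ F {xs = as} v∈Fas)
    ... | b , b∈ , v∈Fb = All.lookup a∉ b∈ (trans (sym (F-head a v∈Fa)) (F-head b v∈Fb))

  ball-unique : ∀ d n → Unique (ball d n)
  ball-unique zero n with parity n
  ... | 0ℙ = [] ∷ []
  ... | 1ℙ = []
  ball-unique (suc d) n =
    concatMap-unique (λ a → map (a ∷_) (ball d (n ∸ ∣ a ∣))) (interval n) (interval-unique n)
      (λ a → Unique.map⁺ (λ { refl → refl }) (ball-unique d (n ∸ ∣ a ∣))) head-a∷
    where
    head-a∷ : ∀ a {v} → v ∈ map (a ∷_) (ball d (n ∸ ∣ a ∣)) → head v ≡ a
    head-a∷ a v∈ with ∈-map⁻ (a ∷_) v∈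
    ... | _ , _ , refl = refl

  count : ℕ → ℕ → ℕ
  count d n = length (ball d n)

  cardP≡count : ∀ d n → cardP (suc d) n ≡ count (suc d) n
  cardP≡count d n = ↭-length (∼bag⇒↭ (unique∧set⇒bag
    (DecUnique.deduplicate-! _≟_ (endpoints (suc d) n)) (ball-unique (suc d) n) (mk⇔ dedup⊆ball ball⊆dedup)))
    where
    _≟_ : DecidableEquality (Vec ℤ (suc d))
    _≟_ = ≡-dec ℤ._≟_
    dedup⊆ball : ∀ {v} → v ∈ deduplicate _≟_ (endpoints (suc d) n) → v ∈ ball (suc d) n
    dedup⊆ball v∈ = Reachable⇒∈ball (suc d) n _
      (∈endpoints⇒Reachable (suc d) n _ (∈-deduplicate⁻ _≟_ (endpoints (suc d) n) v∈))
    ball⊆dedup : ∀ {v} → v ∈ ball (suc d) n → v ∈ deduplicate _≟_ (endpoints (suc d) n)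
    ball⊆dedup v∈ = ∈-deduplicate⁺ _≟_ (Reachable⇒∈endpoints d n _ (∈ball⇒Reachable (suc d) n _ v∈))

  sumOver : List ℤ → (ℤ → ℕ) → ℕ
  sumOver []       f = 0
  sumOver (a ∷ as) f = f a ℕ.+ sumOver as f

  count-suc : ∀ d n → count (suc d) n ≡ sumOver (interval n) (λ a → count d (n ∸ ∣ a ∣))
  count-suc d n = length-concatMap (interval n)
    where
    length-concatMap : ∀ xs → length (concatMap (λ a → map (a ∷_) (ball d (n ∸ ∣ a ∣))) xs)
                              ≡ sumOver xs (λ a → count d (n ∸ ∣ a ∣))
    length-concatMap []       = refl
    length-concatMap (a ∷ as) = trans (length-++ (map (a ∷_) (ball d (n ∸ ∣ a ∣))))
      (cong₂ ℕ._+_ (length-map (a ∷_) (ball d (n ∸ ∣ a ∣))) (length-concatMap as))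

module Sums where

  open import Data.Nat using (ℕ; zero; suc; _+_; _*_)
  open import Data.Nat.Properties
  open import Data.Nat.Solver using (module +-*-Solver)
  open import Relation.Binary.PropositionalEquality

  ∑ : (ℕ → ℕ) → ℕ → ℕ
  ∑ f zero    = 0
  ∑ f (suc n) = ∑ f n + f n

  ∑-cong : ∀ {f g} n → (∀ k → f k ≡ g k) → ∑ f n ≡ ∑ g n
  ∑-cong zero    f≡g = refl
  ∑-cong (suc n) f≡g = cong₂ _+_ (∑-cong n f≡g) (f≡g n)

  ∑-0 : ∀ n → ∑ (λ _ → 0) n ≡ 0
  ∑-0 zero    = refl
  ∑-0 (suc n) = cong (_+ 0) (∑-0 n)

  ∑-distrib-+ : ∀ f g n → ∑ (λ k → f k + g k) n ≡ ∑ f n + ∑ g n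
  ∑-distrib-+ f g zero    = refl
  ∑-distrib-+ f g (suc n) rewrite ∑-distrib-+ f g n = ring (∑ f n) (∑ g n) (f n) (g n)
    where
    open +-*-Solver
    ring : ∀ a b c d → (a + b) + (c + d) ≡ (a + c) + (b + d)
    ring = solve 4 (λ a b c d → (a :+ b) :+ (c :+ d) := (a :+ c) :+ (b :+ d)) refl

  ∑-distribˡ-* : ∀ c f n → ∑ (λ k → c * f k) n ≡ c * ∑ f n
  ∑-distribˡ-* c f zero    = sym (*-zeroʳ c)
  ∑-distribˡ-* c f (suc n) rewrite ∑-distribˡ-* c f n = sym (*-distribˡ-+ c (∑ f n) (f n))

  ∑-suc : ∀ f n → ∑ f (suc n) ≡ f 0 + ∑ (λ k → f (suc k)) n
  ∑-suc f zero    = +-comm 0 (f 0)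
  ∑-suc f (suc n) rewrite ∑-suc f n = +-assoc (f 0) _ _

  ∑-comm : ∀ (f : ℕ → ℕ → ℕ) m n → ∑ (λ i → ∑ (f i) n) m ≡ ∑ (λ j → ∑ (λ i → f i j) m) n
  ∑-comm f zero    n = sym (∑-0 n)
  ∑-comm f (suc m) n rewrite ∑-comm f m n = sym (∑-distrib-+ (λ j → ∑ (λ i → f i j) m) (f m) n)

module Counting where

  open import Data.Nat using (ℕ; zero; suc; _+_; _*_; _∸_; _^_; _!; z≤n; s≤s)
  open import Data.List using ([]; _∷_)
  open import Data.Nat.Properties
  open import Data.Nat.Combinatorics using (_C_; nCk+nC[k+1]≡[n+1]C[k+1]; k>n⇒nCk≡0; nCk≡nC[n∸k]; nCn≡1; nC1≡n)
  open import Data.Nat.Solver using (module +-*-Solver)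
  open import Data.Integer using (∣_∣)
  open import Data.List.Relation.Unary.Any using (here; there)
  open import Data.List.Membership.Propositional using (_∈_)
  open import Relation.Binary.PropositionalEquality
  open Sums
  open Walks

  sumOver-cong : ∀ xs {f g} → (∀ {a} → a ∈ xs → f a ≡ g a) → sumOver xs f ≡ sumOver xs g
  sumOver-cong []       f≡g = refl
  sumOver-cong (a ∷ as) f≡g = cong₂ _+_ (f≡g (here refl)) (sumOver-cong as (λ a∈ → f≡g (there a∈)))

  -- a and -a contribute alike, and shifting n to n + 1 shifts every summand.
  sumOver-interval : ∀ h n → sumOver (interval n) (λ a → h (n ∸ ∣ a ∣)) ≡ h n + 2 * ∑ h n
  sumOver-interval h zero    = refl
  sumOver-interval h (suc n) rewrite n∸n≡0 n
    | sumOver-cong (interval n) {λ a → h (suc n ∸ ∣ a ∣)} {λ a → h (suc (n ∸ ∣ a ∣))}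
        (λ a∈ → cong h (+-∸-assoc 1 (∈interval⇒∣∣≤ n a∈)))
    | sumOver-interval (λ k → h (suc k)) n
    | ∑-suc h n = ring (h 0) (h (suc n)) (∑ (λ k → h (suc k)) n)
    where
    open +-*-Solver
    ring : ∀ a b x → a + (a + (b + 2 * x)) ≡ b + 2 * (a + x)
    ring = solve 3 (λ a b x → a :+ (a :+ (b :+ con 2 :* x)) := b :+ con 2 :* (a :+ x)) refl

  count-rec : ∀ d n → count (suc d) n ≡ count d n + 2 * ∑ (count d) n
  count-rec d n = trans (count-suc d n) (sumOver-interval (count d) n)

  count-one : ∀ n → count 1 n ≡ suc n
  count-one n = trans (count-rec 0 n) (parity-sum n)
    where
    parity-pair : ∀ n → count 0 n + count 0 (suc n) ≡ 1
    parity-pair zero          = refl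
    parity-pair (suc zero)    = refl
    parity-pair (suc (suc n)) = parity-pair n
    parity-sum : ∀ n → count 0 n + 2 * ∑ (count 0) n ≡ suc n
    parity-sum zero          = refl
    parity-sum (suc zero)    = refl
    parity-sum (suc (suc n)) = begin
      c n + 2 * ((∑ c n + c n) + c (suc n))
        ≡⟨ ring (c n) (c (suc n)) (∑ c n) ⟩
      (c n + 2 * ∑ c n) + 2 * (c n + c (suc n))
        ≡⟨ cong₂ (λ a b → a + 2 * b) (parity-sum n) (parity-pair n) ⟩
      suc n + 2 * 1
        ≡⟨ +-comm (suc n) 2 ⟩
      suc (suc (suc n)) ∎
      where
      open ≡-Reasoning
      open +-*-Solver
      c : ℕ → ℕ
      c = count 0
      ring : ∀ a b s → a + 2 * ((s + a) + b) ≡ (a + 2 * s) + 2 * (a + b)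
      ring = solve 3 (λ a b s → a :+ con 2 :* ((s :+ a) :+ b) := (a :+ con 2 :* s) :+ con 2 :* (a :+ b)) refl

  nC0≡1 : ∀ n → n C 0 ≡ 1
  nC0≡1 n = trans (nCk≡nC[n∸k] {k = 0} {n = n} z≤n) (nCn≡1 n)

  0C[1+k]≡0 : ∀ k → 0 C suc k ≡ 0
  0C[1+k]≡0 k = k>n⇒nCk≡0 {n = 0} {k = suc k} (s≤s z≤n)

  ∑mCk≡nC[k+1] : ∀ k n → ∑ (λ m → m C k) n ≡ n C suc k
  ∑mCk≡nC[k+1] k zero    = sym (0C[1+k]≡0 k)
  ∑mCk≡nC[k+1] k (suc n) rewrite ∑mCk≡nC[k+1] k n =
    trans (+-comm (n C suc k) (n C k)) (nCk+nC[k+1]≡[n+1]C[k+1] n k)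

  β : ℕ → ℕ → ℕ
  β zero    zero          = 1
  β zero    (suc zero)    = 1
  β zero    (suc (suc k)) = 0
  β (suc d) zero          = β d zero
  β (suc d) (suc k)       = β d (suc k) + 2 * β d k

  β-vanishes : ∀ d k → β d (2 + d + k) ≡ 0
  β-vanishes zero    k = refl
  β-vanishes (suc d) k rewrite sym (+-suc d k) | β-vanishes d (suc k) | +-suc d k | β-vanishes d k = refl

  β-top : ∀ d → β d (suc d) ≡ 2 ^ d
  β-top zero    = refl
  β-top (suc d) rewrite β-top d = cong (_+ 2 * 2 ^ d) (subst (λ j → β d (2 + j) ≡ 0) (+-identityʳ d) (β-vanishes d 0))

  count≡∑βC : ∀ d n → count (suc d) n ≡ ∑ (λ k → β d k * (n C k)) (2 + d)
  count≡∑βC zero    n = begin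
    count 1 n                        ≡⟨ count-one n ⟩
    1 + n                            ≡⟨ cong₂ _+_ (nC0≡1 n) (nC1≡n n) ⟨
    n C 0 + n C 1                    ≡⟨ cong₂ _+_ (*-identityˡ (n C 0)) (*-identityˡ (n C 1)) ⟨
    ∑ (λ k → β 0 k * (n C k)) 2        ∎
    where open ≡-Reasoning
  count≡∑βC (suc d) n = begin
    count (2 + d) n
      ≡⟨ count-rec (suc d) n ⟩
    count (suc d) n + 2 * ∑ (count (suc d)) n
      ≡⟨ cong₂ (λ a b → a + 2 * b) (count≡∑βC d n) (∑-cong n (count≡∑βC d)) ⟩
    ∑ F L + 2 * ∑ (λ m → ∑ (λ k → β d k * (m C k)) L) n
      ≡⟨ cong (λ s → ∑ F L + 2 * s) (∑-comm (λ m k → β d k * (m C k)) n L) ⟩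
    ∑ F L + 2 * ∑ (λ k → ∑ (λ m → β d k * (m C k)) n) L
      ≡⟨ cong (λ s → ∑ F L + 2 * s) (∑-cong L hockey-stick) ⟩
    ∑ F L + 2 * ∑ G L
      ≡⟨ cong (λ s → s + 2 * ∑ G L) (trans (sym (+-identityʳ (∑ F L)))
                                            (cong (λ b → ∑ F L + b * (n C L)) (sym β-L≡0))) ⟩
    ∑ F (suc L) + 2 * ∑ G L
      ≡⟨ cong₂ _+_ (∑-suc F L) (sym (∑-distribˡ-* 2 G L)) ⟩
    (F 0 + ∑ (λ k → F (suc k)) L) + ∑ (λ k → 2 * G k) L
      ≡⟨ +-assoc (F 0) _ _ ⟩
    F 0 + (∑ (λ k → F (suc k)) L + ∑ (λ k → 2 * G k) L)
      ≡⟨ cong (F 0 +_) (sym (∑-distrib-+ (λ k → F (suc k)) (λ k → 2 * G k) L)) ⟩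
    F 0 + ∑ (λ k → F (suc k) + 2 * G k) L
      ≡⟨ cong (F 0 +_) (∑-cong L (λ k → ring (β d (suc k)) (β d k) (n C suc k))) ⟩
    F 0 + ∑ (λ k → β (suc d) (suc k) * (n C suc k)) L
      ≡⟨ ∑-suc (λ k → β (suc d) k * (n C k)) L ⟨
    ∑ (λ k → β (suc d) k * (n C k)) (suc L) ∎
    where
    open ≡-Reasoning
    L : ℕ
    L = 2 + d
    F G : ℕ → ℕ
    F k = β d k * (n C k)
    G k = β d k * (n C suc k)
    hockey-stick : ∀ k → ∑ (λ m → β d k * (m C k)) n ≡ G k
    hockey-stick k = trans (∑-distribˡ-* (β d k) (λ m → m C k) n) (cong (β d k *_) (∑mCk≡nC[k+1] k n))
    β-L≡0 : β d L ≡ 0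
    β-L≡0 = subst (λ j → β d (2 + j) ≡ 0) (+-identityʳ d) (β-vanishes d 0)
    open +-*-Solver
    ring : ∀ a b c → a * c + 2 * (b * c) ≡ (a + 2 * b) * c
    ring = solve 3 (λ a b c → a :* c :+ con 2 :* (b :* c) := (a :+ con 2 :* b) :* c) refl

  β-diagonal : ∀ k → β (suc k) (suc k) ≡ 2 ^ k * (k + 3)
  β-diagonal zero    = refl
  β-diagonal (suc k) rewrite β-top (suc k) | β-diagonal k = ring (2 ^ k) k
    where
    open +-*-Solver
    ring : ∀ p k → 2 * p + 2 * (p * (k + 3)) ≡ 2 * p * (suc k + 3)
    ring = solve 2 (λ p k → con 2 :* p :+ con 2 :* (p :* (k :+ con 3)) := con 2 :* p :* ((con 1 :+ k) :+ con 3)) refl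

  β-subdiagonal : ∀ k → 4 * β (suc k) k ≡ 2 ^ k * (k + 1) * (k + 4)
  β-subdiagonal zero    = refl
  β-subdiagonal (suc k) = begin
    4 * (β (suc k) (suc k) + 2 * β (suc k) k)
      ≡⟨ ring₁ (β (suc k) (suc k)) (β (suc k) k) ⟩
    4 * β (suc k) (suc k) + 2 * (4 * β (suc k) k)
      ≡⟨ cong₂ (λ a b → 4 * a + 2 * b) (β-diagonal k) (β-subdiagonal k) ⟩
    4 * (2 ^ k * (k + 3)) + 2 * (2 ^ k * (k + 1) * (k + 4))
      ≡⟨ ring₂ (2 ^ k) k ⟩
    2 * 2 ^ k * (suc k + 1) * (suc k + 4) ∎
    where
    open ≡-Reasoning
    open +-*-Solver
    ring₁ : ∀ a b → 4 * (a + 2 * b) ≡ 4 * a + 2 * (4 * b)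
    ring₁ = solve 2 (λ a b → con 4 :* (a :+ con 2 :* b) := con 4 :* a :+ con 2 :* (con 4 :* b)) refl
    ring₂ : ∀ p k → 4 * (p * (k + 3)) + 2 * (p * (k + 1) * (k + 4)) ≡ 2 * p * (suc k + 1) * (suc k + 4)
    ring₂ = solve 2 (λ p k → con 4 :* (p :* (k :+ con 3)) :+ con 2 :* (p :* (k :+ con 1) :* (k :+ con 4))
                          := con 2 :* p :* ((con 1 :+ k) :+ con 1) :* ((con 1 :+ k) :+ con 4)) refl

  nCk*n≡nCk*k+[k+1]*nC[k+1] : ∀ n k → (n C k) * n ≡ (n C k) * k + suc k * (n C suc k)
  nCk*n≡nCk*k+[k+1]*nC[k+1] zero    zero    = refl
  nCk*n≡nCk*k+[k+1]*nC[k+1] zero    (suc k) rewrite 0C[1+k]≡0 k | 0C[1+k]≡0 (suc k) = sym (*-zeroʳ (2 + k))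
  nCk*n≡nCk*k+[k+1]*nC[k+1] (suc n) zero    rewrite nC0≡1 (suc n) | nC1≡n (suc n) =
    cong suc (trans (+-identityʳ n) (sym (+-identityʳ n)))
  nCk*n≡nCk*k+[k+1]*nC[k+1] (suc n) (suc k) = begin
    (suc n C suc k) * suc n
      ≡⟨ cong (_* suc n) (pascal k) ⟨
    (x + y) * suc n
      ≡⟨ ring₁ x y n ⟩
    (x * n + y * n) + (x + y)
      ≡⟨ cong₂ (λ a b → (a + b) + (x + y)) (nCk*n≡nCk*k+[k+1]*nC[k+1] n k) (nCk*n≡nCk*k+[k+1]*nC[k+1] n (suc k)) ⟩
    ((x * k + suc k * y) + (y * suc k + suc (suc k) * z)) + (x + y)
      ≡⟨ ring₂ x y z k ⟩
    (x + y) * suc k + suc (suc k) * (y + z)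
      ≡⟨ cong₂ (λ a b → a * suc k + suc (suc k) * b) (pascal k) (pascal (suc k)) ⟩
    (suc n C suc k) * suc k + suc (suc k) * (suc n C suc (suc k)) ∎
    where
    open ≡-Reasoning
    x y z : ℕ
    x = n C k
    y = n C suc k
    z = n C suc (suc k)
    pascal : ∀ k → n C k + n C suc k ≡ suc n C suc k
    pascal = nCk+nC[k+1]≡[n+1]C[k+1] n
    open +-*-Solver
    ring₁ : ∀ x y n → (x + y) * suc n ≡ (x * n + y * n) + (x + y)
    ring₁ = solve 3 (λ x y n → (x :+ y) :* (con 1 :+ n) := (x :* n :+ y :* n) :+ (x :+ y)) refl
    ring₂ : ∀ x y z k → ((x * k + suc k * y) + (y * suc k + suc (suc k) * z)) + (x + y)
                        ≡ (x + y) * suc k + suc (suc k) * (y + z)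
    ring₂ = solve 4 (λ x y z k → ((x :* k :+ (con 1 :+ k) :* y) :+ (y :* (con 1 :+ k) :+ (con 2 :+ k) :* z)) :+ (x :+ y)
                              := (x :+ y) :* (con 1 :+ k) :+ (con 2 :+ k) :* (y :+ z)) refl

  nCk*[n∸k]≡[k+1]*nC[k+1] : ∀ n k → (n C k) * (n ∸ k) ≡ suc k * (n C suc k)
  nCk*[n∸k]≡[k+1]*nC[k+1] n k = begin
    (n C k) * (n ∸ k)                                   ≡⟨ *-distribˡ-∸ (n C k) n k ⟩
    (n C k) * n ∸ (n C k) * k                           ≡⟨ cong (_∸ (n C k) * k) (nCk*n≡nCk*k+[k+1]*nC[k+1] n k) ⟩
    ((n C k) * k + suc k * (n C suc k)) ∸ (n C k) * k   ≡⟨ m+n∸m≡n ((n C k) * k) _ ⟩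
    suc k * (n C suc k)                                 ∎
    where open ≡-Reasoning

  k!*nCk*[n∸k]≡[k+1]!*nC[k+1] : ∀ n k → k ! * (n C k) * (n ∸ k) ≡ suc k ! * (n C suc k)
  k!*nCk*[n∸k]≡[k+1]!*nC[k+1] n k = begin
    k ! * (n C k) * (n ∸ k)       ≡⟨ *-assoc (k !) (n C k) (n ∸ k) ⟩
    k ! * ((n C k) * (n ∸ k))     ≡⟨ cong (k ! *_) (nCk*[n∸k]≡[k+1]*nC[k+1] n k) ⟩
    k ! * (suc k * (n C suc k))   ≡⟨ *-assoc (k !) (suc k) (n C suc k) ⟨
    k ! * suc k * (n C suc k)     ≡⟨ cong (_* (n C suc k)) (*-comm (k !) (suc k)) ⟩
    suc k ! * (n C suc k)         ∎
    where open ≡-Reasoning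

  rising : ℕ → ℕ → ℕ
  rising k zero    = 1
  rising k (suc m) = suc (k + m) * rising k m

  k!*rising≡[k+m]! : ∀ k m → k ! * rising k m ≡ (k + m) !
  k!*rising≡[k+m]! k zero    rewrite +-identityʳ k = *-identityʳ (k !)
  k!*rising≡[k+m]! k (suc m) rewrite +-suc k m = begin
    k ! * (suc (k + m) * rising k m)   ≡⟨ x∙yz≈y∙xz (k !) (suc (k + m)) (rising k m) ⟩
    suc (k + m) * (k ! * rising k m)   ≡⟨ cong (suc (k + m) *_) (k!*rising≡[k+m]! k m) ⟩
    suc (k + m) * (k + m) !            ∎
    where
    open ≡-Reasoning
    open import Algebra.Properties.CommutativeSemigroup *-commutativeSemigroup using (x∙yz≈y∙xz)

  rising-one : ∀ k → rising (suc k) 1 ≡ k + 2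
  rising-one = solve 1 (λ k → (con 1 :+ ((con 1 :+ k) :+ con 0)) :* con 1 := k :+ con 2) refl
    where open +-*-Solver

  rising-two : ∀ k → rising k 2 ≡ (k + 2) * (k + 1)
  rising-two = solve 1 (λ k → (con 1 :+ (k :+ con 1)) :* ((con 1 :+ (k :+ con 0)) :* con 1) := (k :+ con 2) :* (k :+ con 1)) refl
    where open +-*-Solver

module IntegerPolynomial where

  open import Data.Nat as ℕ using (ℕ; zero; suc; _!)
  import Data.Nat.Properties as ℕ
  open import Data.Nat.Combinatorics using (_C_; k>n⇒nCk≡0)
  open import Data.Integer using (ℤ; +_; _+_; _*_; -_; _-_)
  open import Data.Integer.Properties
  open import Data.Integer.Solver using (module +-*-Solver)
  open import Data.List using (List; []; _∷_)
  open import Data.Sum using (inj₁; inj₂)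
  open import Relation.Binary.PropositionalEquality
  open +-*-Solver
  open Counting using (nC0≡1; k!*nCk*[n∸k]≡[k+1]!*nC[k+1])

  evalℤ : List ℤ → ℕ → ℤ
  evalℤ []       n = + 0
  evalℤ (c ∷ cs) n = c + + n * evalℤ cs n

  coeffℤ : List ℤ → ℕ → ℤ
  coeffℤ []       k       = + 0
  coeffℤ (c ∷ cs) zero    = c
  coeffℤ (c ∷ cs) (suc k) = coeffℤ cs k

  infixl 6 _+ₚ_
  _+ₚ_ : List ℤ → List ℤ → List ℤ
  []      +ₚ B       = B
  (a ∷ A) +ₚ []      = a ∷ A
  (a ∷ A) +ₚ (b ∷ B) = a + b ∷ A +ₚ B

  infixl 7 _·ₚ_
  _·ₚ_ : ℤ → List ℤ → List ℤ
  c ·ₚ []      = []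
  c ·ₚ (a ∷ A) = c * a ∷ c ·ₚ A

  eval-+ₚ : ∀ A B n → evalℤ (A +ₚ B) n ≡ evalℤ A n + evalℤ B n
  eval-+ₚ []      B       n = sym (+-identityˡ _)
  eval-+ₚ (a ∷ A) []      n = sym (+-identityʳ _)
  eval-+ₚ (a ∷ A) (b ∷ B) n rewrite eval-+ₚ A B n = ring a b (+ n) (evalℤ A n) (evalℤ B n)
    where
    ring : ∀ a b x e f → (a + b) + x * (e + f) ≡ (a + x * e) + (b + x * f)
    ring = solve 5 (λ a b x e f → (a :+ b) :+ x :* (e :+ f) := (a :+ x :* e) :+ (b :+ x :* f)) refl

  coeff-+ₚ : ∀ A B k → coeffℤ (A +ₚ B) k ≡ coeffℤ A k + coeffℤ B k
  coeff-+ₚ []      B       k       = sym (+-identityˡ _)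
  coeff-+ₚ (a ∷ A) []      k       = sym (+-identityʳ _)
  coeff-+ₚ (a ∷ A) (b ∷ B) zero    = refl
  coeff-+ₚ (a ∷ A) (b ∷ B) (suc k) = coeff-+ₚ A B k

  eval-·ₚ : ∀ c A n → evalℤ (c ·ₚ A) n ≡ c * evalℤ A n
  eval-·ₚ c []      n = sym (*-zeroʳ c)
  eval-·ₚ c (a ∷ A) n rewrite eval-·ₚ c A n = ring c a (+ n) (evalℤ A n)
    where
    ring : ∀ c a x e → c * a + x * (c * e) ≡ c * (a + x * e)
    ring = solve 4 (λ c a x e → c :* a :+ x :* (c :* e) := c :* (a :+ x :* e)) refl

  coeff-·ₚ : ∀ c A k → coeffℤ (c ·ₚ A) k ≡ c * coeffℤ A k
  coeff-·ₚ c []      k       = sym (*-zeroʳ c)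
  coeff-·ₚ c (a ∷ A) zero    = refl
  coeff-·ₚ c (a ∷ A) (suc k) = coeff-·ₚ c A k

  addHead : ℤ → List ℤ → List ℤ
  addHead p []      = p ∷ []
  addHead p (t ∷ T) = p + t ∷ T

  eval-addHead : ∀ p T n → evalℤ (addHead p T) n ≡ p + evalℤ T n
  eval-addHead p []      n = cong (λ e → p + e) (*-zeroʳ (+ n))
  eval-addHead p (t ∷ T) n = +-assoc p t _

  mulXMinus : ℤ → List ℤ → List ℤ
  mulXMinus a []      = []
  mulXMinus a (p ∷ P) = - (a * p) ∷ addHead p (mulXMinus a P)

  eval-mulXMinus : ∀ a P n → evalℤ (mulXMinus a P) n ≡ evalℤ P n * (+ n - a)
  eval-mulXMinus a []      n = refl
  eval-mulXMinus a (p ∷ P) n rewrite eval-addHead p (mulXMinus a P) n | eval-mulXMinus a P n =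
    ring a p (+ n) (evalℤ P n)
    where
    ring : ∀ a p x e → - (a * p) + x * (p + e * (x - a)) ≡ (p + x * e) * (x - a)
    ring = solve 4 (λ a p x e → :- (a :* p) :+ x :* (p :+ e :* (x :- a)) := (p :+ x :* e) :* (x :- a)) refl

  coeff-mulXMinus-zero : ∀ a P → coeffℤ (mulXMinus a P) 0 ≡ - (a * coeffℤ P 0)
  coeff-mulXMinus-zero a []      = cong -_ (sym (*-zeroʳ a))
  coeff-mulXMinus-zero a (p ∷ P) = refl

  coeff-mulXMinus-suc : ∀ a P j → coeffℤ (mulXMinus a P) (suc j) ≡ coeffℤ P j - a * coeffℤ P (suc j)
  coeff-mulXMinus-suc a []      j = sym (cong (λ e → + 0 - e) (*-zeroʳ a))
  coeff-mulXMinus-suc a (p ∷ P) zero with mulXMinus a P | coeff-mulXMinus-zero a P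
  ... | []    | e = trans (sym (+-identityʳ p)) (cong (λ c → p + c) e)
  ... | t ∷ T | e = cong (λ c → p + c) e
  coeff-mulXMinus-suc a (p ∷ P) (suc j) with mulXMinus a P | coeff-mulXMinus-suc a P j
  ... | []    | e = e
  ... | t ∷ T | e = e

  fallingPoly : ℕ → List ℤ
  fallingPoly zero    = + 1 ∷ []
  fallingPoly (suc k) = mulXMinus (+ k) (fallingPoly k)

  eval-fallingPoly : ∀ k n → evalℤ (fallingPoly k) n ≡ + (k ! ℕ.* (n C k))
  eval-fallingPoly zero    n =
    trans (cong (λ e → + 1 + e) (*-zeroʳ (+ n))) (cong +_ (sym (trans (ℕ.+-identityʳ (n C 0)) (nC0≡1 n))))
  eval-fallingPoly (suc k) n rewrite eval-mulXMinus (+ k) (fallingPoly k) n | eval-fallingPoly k n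
    with ℕ.≤-<-connex k n
  ... | inj₁ k≤n = begin
    + (k ! ℕ.* (n C k)) * (+ n - + k) ≡⟨ cong (+ (k ! ℕ.* (n C k)) *_) (trans (m-n≡m⊖n n k) (⊖-≥ k≤n)) ⟩
    + (k ! ℕ.* (n C k)) * + (n ℕ.∸ k) ≡⟨ pos-* (k ! ℕ.* (n C k)) (n ℕ.∸ k) ⟨
    + (k ! ℕ.* (n C k) ℕ.* (n ℕ.∸ k)) ≡⟨ cong +_ (k!*nCk*[n∸k]≡[k+1]!*nC[k+1] n k) ⟩
    + (suc k ! ℕ.* (n C suc k)) ∎
    where open ≡-Reasoning
  ... | inj₂ n<k rewrite k>n⇒nCk≡0 n<k | k>n⇒nCk≡0 (ℕ.m<n⇒m<1+n n<k) | ℕ.*-zeroʳ (k !) | ℕ.*-zeroʳ (suc k !)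
    = refl

  coeff-fallingPoly-above : ∀ k j → coeffℤ (fallingPoly k) (suc (k ℕ.+ j)) ≡ + 0
  coeff-fallingPoly-above zero    j = refl
  coeff-fallingPoly-above (suc k) j
    rewrite coeff-mulXMinus-suc (+ k) (fallingPoly k) (suc (k ℕ.+ j)) | coeff-fallingPoly-above k j
          | sym (ℕ.+-suc k j) | coeff-fallingPoly-above k (suc j) = cong (λ e → + 0 - e) (*-zeroʳ (+ k))

  coeff-fallingPoly-top : ∀ k → coeffℤ (fallingPoly k) k ≡ + 1
  coeff-fallingPoly-top zero    = refl
  coeff-fallingPoly-top (suc k)
    rewrite coeff-mulXMinus-suc (+ k) (fallingPoly k) k | coeff-fallingPoly-top k
          | subst (λ j → coeffℤ (fallingPoly k) (suc j) ≡ + 0) (ℕ.+-identityʳ k) (coeff-fallingPoly-above k 0)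
    = cong (λ e → + 1 - e) (*-zeroʳ (+ k))

  coeff-fallingPoly-next : ∀ k → + 2 * coeffℤ (fallingPoly (suc k)) k ≡ - (+ k * (+ k + + 1))
  coeff-fallingPoly-next zero    = refl
  coeff-fallingPoly-next (suc k) = begin
    + 2 * coeffℤ (mulXMinus (+ suc k) (fallingPoly (suc k))) (suc k)
      ≡⟨ cong (+ 2 *_) (coeff-mulXMinus-suc (+ suc k) (fallingPoly (suc k)) k) ⟩
    + 2 * (coeffℤ (fallingPoly (suc k)) k - + suc k * coeffℤ (fallingPoly (suc k)) (suc k))
      ≡⟨ cong (λ c → + 2 * (coeffℤ (fallingPoly (suc k)) k - + suc k * c)) (coeff-fallingPoly-top (suc k)) ⟩
    + 2 * (coeffℤ (fallingPoly (suc k)) k - + suc k * + 1)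
      ≡⟨ ring₁ (coeffℤ (fallingPoly (suc k)) k) (+ suc k) ⟩
    + 2 * coeffℤ (fallingPoly (suc k)) k - + 2 * + suc k
      ≡⟨ cong₂ (λ c s → c - + 2 * s) (coeff-fallingPoly-next k) 1+k≡k+1 ⟩
    - (+ k * (+ k + + 1)) - + 2 * (+ k + + 1)
      ≡⟨ ring₂ (+ k) ⟩
    - ((+ k + + 1) * ((+ k + + 1) + + 1))
      ≡⟨ cong (λ m → - (m * (m + + 1))) 1+k≡k+1 ⟨
    - (+ suc k * (+ suc k + + 1)) ∎
    where
    open ≡-Reasoning
    1+k≡k+1 : + suc k ≡ + k + + 1
    1+k≡k+1 = cong +_ (ℕ.+-comm 1 k)
    ring₁ : ∀ c s → + 2 * (c - s * + 1) ≡ + 2 * c - + 2 * s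
    ring₁ = solve 2 (λ c s → con (+ 2) :* (c :- s :* con (+ 1)) := con (+ 2) :* c :- con (+ 2) :* s) refl
    ring₂ : ∀ k → - (k * (k + + 1)) - + 2 * (k + + 1) ≡ - ((k + + 1) * ((k + + 1) + + 1))
    ring₂ = solve 1 (λ k → :- (k :* (k :+ con (+ 1))) :- con (+ 2) :* (k :+ con (+ 1))
                        := :- ((k :+ con (+ 1)) :* ((k :+ con (+ 1)) :+ con (+ 1)))) refl

  coeff-fallingPoly-next₂ : ∀ k →
    + 24 * coeffℤ (fallingPoly (2 ℕ.+ k)) k ≡ + k * (+ k + + 1) * (+ k + + 2) * (+ 3 * + k + + 5)
  coeff-fallingPoly-next₂ zero    = refl
  coeff-fallingPoly-next₂ (suc k) = begin
    + 24 * coeffℤ (mulXMinus t (fallingPoly (2 ℕ.+ k))) (suc k)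
      ≡⟨ cong (+ 24 *_) (coeff-mulXMinus-suc t (fallingPoly (2 ℕ.+ k)) k) ⟩
    + 24 * (b - t * a)
      ≡⟨ ring₁ b a t ⟩
    + 24 * b - + 12 * t * (+ 2 * a)
      ≡⟨ cong₂ (λ x y → x - + 12 * t * y) (coeff-fallingPoly-next₂ k) (coeff-fallingPoly-next (suc k)) ⟩
    + k * (+ k + + 1) * (+ k + + 2) * (+ 3 * + k + + 5) - + 12 * t * - (+ suc k * (+ suc k + + 1))
      ≡⟨ cong₂ (λ t s → + k * (+ k + + 1) * (+ k + + 2) * (+ 3 * + k + + 5) - + 12 * t * - (s * (s + + 1)))
               (cong +_ (ℕ.+-comm 2 k)) (cong +_ (ℕ.+-comm 1 k)) ⟩
    + k * (+ k + + 1) * (+ k + + 2) * (+ 3 * + k + + 5) - + 12 * (+ k + + 2) * - ((+ k + + 1) * ((+ k + + 1) + + 1))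
      ≡⟨ ring₂ (+ k) ⟩
    (+ k + + 1) * ((+ k + + 1) + + 1) * ((+ k + + 1) + + 2) * (+ 3 * (+ k + + 1) + + 5)
      ≡⟨ cong (λ s → s * (s + + 1) * (s + + 2) * (+ 3 * s + + 5)) (cong +_ (ℕ.+-comm 1 k)) ⟨
    + suc k * (+ suc k + + 1) * (+ suc k + + 2) * (+ 3 * + suc k + + 5) ∎
    where
    open ≡-Reasoning
    t a b : ℤ
    t = + (2 ℕ.+ k)
    a = coeffℤ (fallingPoly (2 ℕ.+ k)) (suc k)
    b = coeffℤ (fallingPoly (2 ℕ.+ k)) k
    ring₁ : ∀ b a t → + 24 * (b - t * a) ≡ + 24 * b - + 12 * t * (+ 2 * a)
    ring₁ = solve 3 (λ b a t → con (+ 24) :* (b :- t :* a) := con (+ 24) :* b :- con (+ 12) :* t :* (con (+ 2) :* a)) refl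
    ring₂ : ∀ k → k * (k + + 1) * (k + + 2) * (+ 3 * k + + 5) - + 12 * (k + + 2) * - ((k + + 1) * ((k + + 1) + + 1))
                  ≡ (k + + 1) * ((k + + 1) + + 1) * ((k + + 1) + + 2) * (+ 3 * (k + + 1) + + 5)
    ring₂ = solve 1 (λ k → k :* (k :+ con (+ 1)) :* (k :+ con (+ 2)) :* (con (+ 3) :* k :+ con (+ 5))
                             :- con (+ 12) :* (k :+ con (+ 2)) :* (:- ((k :+ con (+ 1)) :* ((k :+ con (+ 1)) :+ con (+ 1))))
                        := (k :+ con (+ 1)) :* ((k :+ con (+ 1)) :+ con (+ 1)) :* ((k :+ con (+ 1)) :+ con (+ 2))
                           :* (con (+ 3) :* (k :+ con (+ 1)) :+ con (+ 5))) refl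

module IntegerArithmetic where

  open import Data.Integer using (ℤ; +_; _+_; _*_; -_)
  open import Data.Integer.Properties using (*-cancelˡ-≡)
  open import Data.Integer.Solver using (module +-*-Solver)
  open import Relation.Binary.PropositionalEquality
  open +-*-Solver

  cong₃ : ∀ {x x′ y y′ z z′ : ℤ} (f : ℤ → ℤ → ℤ → ℤ) → x ≡ x′ → y ≡ y′ → z ≡ z′ → f x y z ≡ f x′ y′ z′
  cong₃ f refl refl refl = refl

  -- After multiplying by 4 the left side is a combination of 4 b₀, 2 a and 24 b, whose values are known.
  leading-identity : ∀ p k b₀ b₁ b₂ a b →
    + 4 * b₀ ≡ p * (k + + 1) * (k + + 4) → b₁ ≡ p * (k + + 3) → b₂ ≡ + 2 * p →
    + 2 * a ≡ - (k * (k + + 1)) → + 24 * b ≡ k * (k + + 1) * (k + + 2) * (+ 3 * k + + 5) →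
    (b₀ * ((k + + 2) * (k + + 1)) + b₁ * (k + + 2) * a + b₂ * b) * + 6 ≡ p * (k + + 6) * ((k + + 2) * (k + + 1))
  leading-identity p k b₀ _ _ a b 4b₀≡ refl refl 2a≡ 24b≡ = *-cancelˡ-≡ (+ 4) _ _ (begin
    + 4 * ((b₀ * X + Y * a + + 2 * p * b) * + 6)
      ≡⟨ regroup b₀ a b p X Y ⟩
    + 6 * X * (+ 4 * b₀) + + 12 * Y * (+ 2 * a) + + 2 * p * (+ 24 * b)
      ≡⟨ cong₃ (λ x y z → + 6 * X * x + + 12 * Y * y + + 2 * p * z) 4b₀≡ 2a≡ 24b≡ ⟩
    + 6 * X * (p * (k + + 1) * (k + + 4)) + + 12 * Y * - (k * (k + + 1))
      + + 2 * p * (k * (k + + 1) * (k + + 2) * (+ 3 * k + + 5))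
      ≡⟨ expand p k ⟩
    + 4 * (p * (k + + 6) * X) ∎)
    where
    open ≡-Reasoning
    X Y : ℤ
    X = (k + + 2) * (k + + 1)
    Y = p * (k + + 3) * (k + + 2)
    regroup : ∀ b₀ a b p X Y → + 4 * ((b₀ * X + Y * a + + 2 * p * b) * + 6)
                             ≡ + 6 * X * (+ 4 * b₀) + + 12 * Y * (+ 2 * a) + + 2 * p * (+ 24 * b)
    regroup = solve 6 (λ b₀ a b p X Y →
      con (+ 4) :* ((b₀ :* X :+ Y :* a :+ con (+ 2) :* p :* b) :* con (+ 6))
      := con (+ 6) :* X :* (con (+ 4) :* b₀) :+ con (+ 12) :* Y :* (con (+ 2) :* a) :+ con (+ 2) :* p :* (con (+ 24) :* b)) refl
    expand : ∀ p k →
      + 6 * ((k + + 2) * (k + + 1)) * (p * (k + + 1) * (k + + 4)) + + 12 * (p * (k + + 3) * (k + + 2)) * - (k * (k + + 1))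
        + + 2 * p * (k * (k + + 1) * (k + + 2) * (+ 3 * k + + 5))
      ≡ + 4 * (p * (k + + 6) * ((k + + 2) * (k + + 1)))
    expand = solve 2 (λ p k →
      con (+ 6) :* ((k :+ con (+ 2)) :* (k :+ con (+ 1))) :* (p :* (k :+ con (+ 1)) :* (k :+ con (+ 4)))
      :+ con (+ 12) :* (p :* (k :+ con (+ 3)) :* (k :+ con (+ 2))) :* (:- (k :* (k :+ con (+ 1))))
      :+ con (+ 2) :* p :* (k :* (k :+ con (+ 1)) :* (k :+ con (+ 2)) :* (con (+ 3) :* k :+ con (+ 5)))
      := con (+ 4) :* (p :* (k :+ con (+ 6)) :* ((k :+ con (+ 2)) :* (k :+ con (+ 1))))) refl

module CountingPolynomial where

  open import Data.Nat as ℕ using (ℕ; zero; suc; _∸_; _<_; _!)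
  import Data.Nat.Properties as ℕ
  open import Data.Nat.Combinatorics using (_C_)
  import Data.Nat.Solver
  import Data.Integer.Solver
  open import Data.Integer as ℤ using (ℤ; +_)
  import Data.Integer.Properties as ℤ
  open import Data.Rational as ℚ using (_/_)
  open import Data.Rational.Properties using (0/n≡0)
  open import Data.List using (List; []; _∷_; map)
  open import Relation.Binary.PropositionalEquality
  open RationalPolynomial
  open Walks using (count; cardP≡count)
  open Sums
  open Counting
  open IntegerPolynomial

  ∑ₚ : (ℕ → List ℤ) → ℕ → List ℤ
  ∑ₚ F zero    = []
  ∑ₚ F (suc L) = ∑ₚ F L +ₚ F L

  eval-∑ₚ : ∀ F f L n → (∀ k → k < L → evalℤ (F k) n ≡ + f k) → evalℤ (∑ₚ F L) n ≡ + ∑ f L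
  eval-∑ₚ F f zero    n F≗f = refl
  eval-∑ₚ F f (suc L) n F≗f = begin
    evalℤ (∑ₚ F L +ₚ F L) n
      ≡⟨ eval-+ₚ (∑ₚ F L) (F L) n ⟩
    evalℤ (∑ₚ F L) n ℤ.+ evalℤ (F L) n
      ≡⟨ cong₂ ℤ._+_ (eval-∑ₚ F f L n (λ k k<L → F≗f k (ℕ.m<n⇒m<1+n k<L))) (F≗f L ℕ.≤-refl) ⟩
    + ∑ f L ℤ.+ + f L
      ≡⟨ ℤ.pos-+ (∑ f L) (f L) ⟨
    + ∑ f (suc L) ∎
    where open ≡-Reasoning

  coeff-∑ₚ-vanishes : ∀ F L j → (∀ k → k < L → coeffℤ (F k) j ≡ + 0) → coeffℤ (∑ₚ F L) j ≡ + 0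
  coeff-∑ₚ-vanishes F zero    j F≡0 = refl
  coeff-∑ₚ-vanishes F (suc L) j F≡0 = trans (coeff-+ₚ (∑ₚ F L) (F L) j)
    (cong₂ ℤ._+_ (coeff-∑ₚ-vanishes F L j (λ k k<L → F≡0 k (ℕ.m<n⇒m<1+n k<L))) (F≡0 L ℕ.≤-refl))

  countPolyℤ : ℕ → List ℤ
  countPolyℤ d = ∑ₚ (λ k → + (β d k ℕ.* rising k (suc d ∸ k)) ·ₚ fallingPoly k) (2 ℕ.+ d)

  eval-countPolyℤ : ∀ d n → evalℤ (countPolyℤ d) n ≡ + (suc d ! ℕ.* count (suc d) n)
  eval-countPolyℤ d n = begin
    evalℤ (countPolyℤ d) n
      ≡⟨ eval-∑ₚ _ (λ k → suc d ! ℕ.* (β d k ℕ.* (n C k))) (2 ℕ.+ d) n term ⟩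
    + ∑ (λ k → suc d ! ℕ.* (β d k ℕ.* (n C k))) (2 ℕ.+ d)
      ≡⟨ cong +_ (∑-distribˡ-* (suc d !) (λ k → β d k ℕ.* (n C k)) (2 ℕ.+ d)) ⟩
    + (suc d ! ℕ.* ∑ (λ k → β d k ℕ.* (n C k)) (2 ℕ.+ d))
      ≡⟨ cong (λ c → + (suc d ! ℕ.* c)) (count≡∑βC d n) ⟨
    + (suc d ! ℕ.* count (suc d) n) ∎
    where
    open ≡-Reasoning
    term : ∀ k → k < 2 ℕ.+ d → evalℤ (+ (β d k ℕ.* rising k (suc d ∸ k)) ·ₚ fallingPoly k) n
                              ≡ + (suc d ! ℕ.* (β d k ℕ.* (n C k)))
    term k (ℕ.s≤s k≤1+d) = begin
      evalℤ (+ (β d k ℕ.* r) ·ₚ fallingPoly k) n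
        ≡⟨ eval-·ₚ _ (fallingPoly k) n ⟩
      + (β d k ℕ.* r) ℤ.* evalℤ (fallingPoly k) n
        ≡⟨ cong (+ (β d k ℕ.* r) ℤ.*_) (eval-fallingPoly k n) ⟩
      + (β d k ℕ.* r) ℤ.* + (k ! ℕ.* (n C k))
        ≡⟨ ℤ.pos-* (β d k ℕ.* r) (k ! ℕ.* (n C k)) ⟨
      + (β d k ℕ.* r ℕ.* (k ! ℕ.* (n C k)))
        ≡⟨ cong +_ (ring (β d k) r (k !) (n C k)) ⟩
      + ((k ! ℕ.* r) ℕ.* (β d k ℕ.* (n C k)))
        ≡⟨ cong (λ m → + (m ℕ.* (β d k ℕ.* (n C k)))) k!*r≡[1+d]! ⟩
      + (suc d ! ℕ.* (β d k ℕ.* (n C k))) ∎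
      where
      r : ℕ
      r = rising k (suc d ∸ k)
      k!*r≡[1+d]! : k ! ℕ.* r ≡ suc d !
      k!*r≡[1+d]! = trans (k!*rising≡[k+m]! k (suc d ∸ k)) (cong _! (ℕ.m+[n∸m]≡n k≤1+d))
      open Data.Nat.Solver.+-*-Solver
      ring : ∀ b r f c → b ℕ.* r ℕ.* (f ℕ.* c) ≡ (f ℕ.* r) ℕ.* (b ℕ.* c)
      ring = solve 4 (λ b r f c → b :* r :* (f :* c) := (f :* r) :* (b :* c)) refl

  infixl 7 _/!_
  _/!_ : ℤ → ℕ → ℚ.ℚ
  c /! m = (c / m !) {{m ℕ.!≢0}}

  countPoly : ℕ → Poly
  countPoly d = map (_/! suc d) (countPolyℤ d)

  eval-map-/! : ∀ m A n → eval (map (_/! m) A) n ≡ evalℤ A n /! m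
  eval-map-/! m []      n = sym (0/n≡0 (m !) {{m ℕ.!≢0}})
  eval-map-/! m (c ∷ A) n = begin
    c /! m ℚ.+ fromℕ n ℚ.* eval (map (_/! m) A) n
      ≡⟨ cong (λ e → c /! m ℚ.+ fromℕ n ℚ.* e) (eval-map-/! m A n) ⟩
    c /! m ℚ.+ fromℕ n ℚ.* (evalℤ A n /! m)
      ≡⟨ cong (λ e → c /! m ℚ.+ e) (z/1*a/p≡[z*a]/p (+ n) (evalℤ A n) (m !) {{m ℕ.!≢0}}) ⟩
    c /! m ℚ.+ (+ n ℤ.* evalℤ A n) /! m
      ≡⟨ a/p+b/p≡[a+b]/p c (+ n ℤ.* evalℤ A n) (m !) {{m ℕ.!≢0}} ⟩
    (c ℤ.+ + n ℤ.* evalℤ A n) /! m ∎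
    where open ≡-Reasoning

  coeff-map-/! : ∀ m A j → coeff (map (_/! m) A) j ≡ coeffℤ A j /! m
  coeff-map-/! m []      j       = sym (0/n≡0 (m !) {{m ℕ.!≢0}})
  coeff-map-/! m (c ∷ A) zero    = refl
  coeff-map-/! m (c ∷ A) (suc j) = coeff-map-/! m A j

  eval-countPoly : ∀ d n → eval (countPoly d) n ≡ + cardP (suc d) n / 1
  eval-countPoly d n = begin
    eval (countPoly d) n
      ≡⟨ eval-map-/! (suc d) (countPolyℤ d) n ⟩
    evalℤ (countPolyℤ d) n /! suc d
      ≡⟨ cong (_/! suc d) (eval-countPolyℤ d n) ⟩
    + (suc d ! ℕ.* count (suc d) n) /! suc d
      ≡⟨ /-cross (+ (suc d ! ℕ.* count (suc d) n)) (+ count (suc d) n) (suc d !) 1 {{suc d ℕ.!≢0}} cross ⟩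
    + count (suc d) n / 1
      ≡⟨ cong (λ c → + c / 1) (cardP≡count d n) ⟨
    + cardP (suc d) n / 1 ∎
    where
    open ≡-Reasoning
    cross : + (suc d ! ℕ.* count (suc d) n) ℤ.* + 1 ≡ + count (suc d) n ℤ.* + (suc d !)
    cross = trans (ℤ.*-identityʳ _) (trans (cong +_ (ℕ.*-comm (suc d !) _)) (ℤ.pos-* (count (suc d) n) (suc d !)))


  open IntegerArithmetic using (leading-identity)

  pos-*-+ : ∀ m n c → + (m ℕ.* (n ℕ.+ c)) ≡ + m ℤ.* (+ n ℤ.+ + c)
  pos-*-+ m n c = trans (ℤ.pos-* m (n ℕ.+ c)) (cong (+ m ℤ.*_) (ℤ.pos-+ n c))

  pos-*-* : ∀ a b c → + (a ℕ.* (b ℕ.* c)) ≡ + a ℤ.* (+ b ℤ.* + c)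
  pos-*-* a b c = trans (ℤ.pos-* a (b ℕ.* c)) (cong (+ a ℤ.*_) (ℤ.pos-* b c))

  coeff-countPolyℤ-terms : ∀ K → coeffℤ (countPolyℤ (suc K)) K
    ≡ + β (suc K) K ℤ.* ((+ K ℤ.+ + 2) ℤ.* (+ K ℤ.+ + 1))
      ℤ.+ + β (suc K) (suc K) ℤ.* (+ K ℤ.+ + 2) ℤ.* coeffℤ (fallingPoly (suc K)) K
      ℤ.+ + β (suc K) (2 ℕ.+ K) ℤ.* coeffℤ (fallingPoly (2 ℕ.+ K)) K
  coeff-countPolyℤ-terms K = begin
    coeffℤ (∑ₚ F (2 ℕ.+ K) +ₚ F (2 ℕ.+ K)) K
      ≡⟨ coeff-+ₚ (∑ₚ F (2 ℕ.+ K)) (F (2 ℕ.+ K)) K ⟩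
    coeffℤ (∑ₚ F (suc K) +ₚ F (suc K)) K ℤ.+ term (2 ℕ.+ K)
      ≡⟨ cong (ℤ._+ term (2 ℕ.+ K)) (coeff-+ₚ (∑ₚ F (suc K)) (F (suc K)) K) ⟩
    coeffℤ (∑ₚ F K +ₚ F K) K ℤ.+ term (suc K) ℤ.+ term (2 ℕ.+ K)
      ≡⟨ cong (λ c → c ℤ.+ term (suc K) ℤ.+ term (2 ℕ.+ K)) (coeff-+ₚ (∑ₚ F K) (F K) K) ⟩
    coeffℤ (∑ₚ F K) K ℤ.+ term K ℤ.+ term (suc K) ℤ.+ term (2 ℕ.+ K)
      ≡⟨ cong (λ c → c ℤ.+ term K ℤ.+ term (suc K) ℤ.+ term (2 ℕ.+ K)) below ⟩
    + 0 ℤ.+ term K ℤ.+ term (suc K) ℤ.+ term (2 ℕ.+ K)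
      ≡⟨ cong (λ c → c ℤ.+ term (suc K) ℤ.+ term (2 ℕ.+ K)) (ℤ.+-identityˡ (term K)) ⟩
    term K ℤ.+ term (suc K) ℤ.+ term (2 ℕ.+ K)
      ≡⟨ cong₂ ℤ._+_ (cong₂ ℤ._+_ term₀ term₁) term₂ ⟩
    _ ∎
    where
    open ≡-Reasoning
    w : ℕ → ℕ
    w j = β (suc K) j ℕ.* rising j (2 ℕ.+ K ∸ j)
    F : ℕ → List ℤ
    F j = + w j ·ₚ fallingPoly j
    term : ℕ → ℤ
    term j = coeffℤ (F j) K
    term≡ : ∀ j m → 2 ℕ.+ K ∸ j ≡ m → term j ≡ + (β (suc K) j ℕ.* rising j m) ℤ.* coeffℤ (fallingPoly j) K
    term≡ j m refl = coeff-·ₚ (+ w j) (fallingPoly j) K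
    below : coeffℤ (∑ₚ F K) K ≡ + 0
    below = coeff-∑ₚ-vanishes F K K (λ j j<K → trans (coeff-·ₚ (+ w j) (fallingPoly j) K)
      (trans (cong (+ w j ℤ.*_) (subst (λ i → coeffℤ (fallingPoly j) i ≡ + 0) (ℕ.m+[n∸m]≡n j<K)
                                   (coeff-fallingPoly-above j (K ∸ suc j))))
             (ℤ.*-zeroʳ (+ w j))))
    term₀ : term K ≡ + β (suc K) K ℤ.* ((+ K ℤ.+ + 2) ℤ.* (+ K ℤ.+ + 1))
    term₀ = trans (term≡ K 2 (ℕ.m+n∸n≡m 2 K)) (trans
      (cong₂ ℤ._*_ (trans (cong (λ r → + (β (suc K) K ℕ.* r)) (rising-two K)) (pos-*-* (β (suc K) K) (K ℕ.+ 2) (K ℕ.+ 1)))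
                   (coeff-fallingPoly-top K))
      (ℤ.*-identityʳ (+ β (suc K) K ℤ.* ((+ K ℤ.+ + 2) ℤ.* (+ K ℤ.+ + 1)))))
    term₁ : term (suc K) ≡ + β (suc K) (suc K) ℤ.* (+ K ℤ.+ + 2) ℤ.* coeffℤ (fallingPoly (suc K)) K
    term₁ = trans (term≡ (suc K) 1 (ℕ.m+n∸n≡m 1 K)) (cong (ℤ._* coeffℤ (fallingPoly (suc K)) K)
      (trans (cong (λ r → + (β (suc K) (suc K) ℕ.* r)) (rising-one K)) (pos-*-+ (β (suc K) (suc K)) K 2)))
    term₂ : term (2 ℕ.+ K) ≡ + β (suc K) (2 ℕ.+ K) ℤ.* coeffℤ (fallingPoly (2 ℕ.+ K)) K
    term₂ = trans (term≡ (2 ℕ.+ K) 0 (ℕ.n∸n≡0 (2 ℕ.+ K)))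
      (cong (λ c → + c ℤ.* coeffℤ (fallingPoly (2 ℕ.+ K)) K) (ℕ.*-identityʳ (β (suc K) (2 ℕ.+ K))))

  coeff-countPolyℤ : ∀ K → coeffℤ (countPolyℤ (suc K)) K ℤ.* + 6
    ≡ + (2 ℕ.^ K) ℤ.* (+ K ℤ.+ + 6) ℤ.* ((+ K ℤ.+ + 2) ℤ.* (+ K ℤ.+ + 1))
  coeff-countPolyℤ K = trans (cong (ℤ._* + 6) (coeff-countPolyℤ-terms K))
    (leading-identity p k (+ β (suc K) K) (+ β (suc K) (suc K)) (+ β (suc K) (2 ℕ.+ K))
      (coeffℤ (fallingPoly (suc K)) K) (coeffℤ (fallingPoly (2 ℕ.+ K)) K)
      4β₀≡ β₁≡ β₂≡ (coeff-fallingPoly-next K) (coeff-fallingPoly-next₂ K))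
    where
    p k : ℤ
    p = + (2 ℕ.^ K)
    k = + K
    4β₀≡ : + 4 ℤ.* + β (suc K) K ≡ p ℤ.* (k ℤ.+ + 1) ℤ.* (k ℤ.+ + 4)
    4β₀≡ = trans (sym (ℤ.pos-* 4 (β (suc K) K))) (trans (cong +_ (β-subdiagonal K))
             (trans (pos-*-+ (2 ℕ.^ K ℕ.* (K ℕ.+ 1)) K 4) (cong (ℤ._* (k ℤ.+ + 4)) (pos-*-+ (2 ℕ.^ K) K 1))))
    β₁≡ : + β (suc K) (suc K) ≡ p ℤ.* (k ℤ.+ + 3)
    β₁≡ = trans (cong +_ (β-diagonal K)) (pos-*-+ (2 ℕ.^ K) K 3)
    β₂≡ : + β (suc K) (2 ℕ.+ K) ≡ + 2 ℤ.* p
    β₂≡ = trans (cong +_ (β-top (suc K))) (ℤ.pos-* 2 (2 ℕ.^ K))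

  coeff-countPoly : ∀ K → coeff (countPoly (suc K)) K ≡ target K
  coeff-countPoly K = trans (coeff-map-/! (2 ℕ.+ K) (countPolyℤ (suc K)) K)
    (/-cross c (+ (2 ℕ.^ K ℕ.* (K ℕ.+ 2 ℕ.+ 4))) ((2 ℕ.+ K) !) (6 ℕ.* K !)
      {{(2 ℕ.+ K) ℕ.!≢0}} {{ℕ.m*n≢0 6 (K !) {{_}} {{K ℕ.!≢0}}}} cross)
    where
    open ≡-Reasoning
    c p k f : ℤ
    c = coeffℤ (countPolyℤ (suc K)) K
    p = + (2 ℕ.^ K)
    k = + K
    f = + (K !)
    cross : c ℤ.* + (6 ℕ.* K !) ≡ + (2 ℕ.^ K ℕ.* (K ℕ.+ 2 ℕ.+ 4)) ℤ.* + ((2 ℕ.+ K) !)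
    cross = begin
      c ℤ.* + (6 ℕ.* K !)                                      ≡⟨ cong (c ℤ.*_) (ℤ.pos-* 6 (K !)) ⟩
      c ℤ.* (+ 6 ℤ.* f)                                        ≡⟨ ℤ.*-assoc c (+ 6) f ⟨
      c ℤ.* + 6 ℤ.* f                                          ≡⟨ cong (ℤ._* f) (coeff-countPolyℤ K) ⟩
      p ℤ.* (k ℤ.+ + 6) ℤ.* ((k ℤ.+ + 2) ℤ.* (k ℤ.+ + 1)) ℤ.* f ≡⟨ ring p k f ⟩
      (p ℤ.* ((k ℤ.+ + 2) ℤ.+ + 4)) ℤ.* ((+ 2 ℤ.+ k) ℤ.* ((+ 1 ℤ.+ k) ℤ.* f))
        ≡⟨ cong₂ ℤ._*_ (trans (pos-*-+ (2 ℕ.^ K) (K ℕ.+ 2) 4) (cong (λ m → p ℤ.* (m ℤ.+ + 4)) (ℤ.pos-+ K 2)))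
                       (trans (ℤ.pos-* (2 ℕ.+ K) (suc K !))
                              (cong₂ ℤ._*_ (ℤ.pos-+ 2 K) (trans (ℤ.pos-* (suc K) (K !)) (cong (ℤ._* f) (ℤ.pos-+ 1 K))))) ⟨
      + (2 ℕ.^ K ℕ.* (K ℕ.+ 2 ℕ.+ 4)) ℤ.* + ((2 ℕ.+ K) !)        ∎
      where
      open Data.Integer.Solver.+-*-Solver
      ring : ∀ p k f → p ℤ.* (k ℤ.+ + 6) ℤ.* ((k ℤ.+ + 2) ℤ.* (k ℤ.+ + 1)) ℤ.* f
                       ≡ (p ℤ.* ((k ℤ.+ + 2) ℤ.+ + 4)) ℤ.* ((+ 2 ℤ.+ k) ℤ.* ((+ 1 ℤ.+ k) ℤ.* f))
      ring = solve 3 (λ p k f → p :* (k :+ con (+ 6)) :* ((k :+ con (+ 2)) :* (k :+ con (+ 1))) :* f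
                               := (p :* ((k :+ con (+ 2)) :+ con (+ 4))) :* ((con (+ 2) :+ k) :* ((con (+ 1) :+ k) :* f))) refl

open import Data.Nat using (ℕ; suc; s≤s; _≤_; _∸_)
open import Data.Rational using (ℚ; _/_)
open import Data.Integer using (+_)
open import Relation.Binary.PropositionalEquality using (_≡_; trans; sym)
open RationalPolynomial using (coeff-unique)
open CountingPolynomial using (countPoly; eval-countPoly; coeff-countPoly)

mainTheorem7 : (d : ℕ) → 2 ≤ d → (Q : Poly) →
    ((n : ℕ) → eval Q n ≡ (+ cardP d n) / 1) →
    coeff Q (d ∸ 2) ≡ target (d ∸ 2)
mainTheorem7 (suc (suc k)) (s≤s (s≤s _)) Q Q≗cardP = trans
  (coeff-unique Q (countPoly (suc k)) (λ n → trans (Q≗cardP n) (sym (eval-countPoly (suc k) n))) k)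
  (coeff-countPoly k)
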